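{- Let $n$ be odd and let $v\in\mathbb{F}_2^n$ with $v_0=0$ be symmetric, i.e. $v_i=v_{ -i}$ for every $i$ (indices mod $n$). Then $v$ and $\bar e$ work together.
   Context: Vectors in $\mathbb{F}_2^n$ are indexed $x=(x_0,\dots,x_{n-1})$ with indices mod $n$; $\sigma$ is the cyclic shift $(\sigma x)_{i+1}=x_i$. Vectors $v,w$ work together if for every $x\in\mathbb{F}_2^n$ there is $k\in\{0,\dots,n-1\}$ with $v\cdot\sigma^kx=w\cdot\sigma^kx=0$. $\bar e\in\mathbb{F}_2^n$ is the vector with $\bar e_0=0$ and $\bar e_i=1$ for $i\ne0$. -}

module Defs where

open import Data.Nat using (ℕ; zero; suc; _+_; _∸_; NonZero)
open import Data.Nat.DivMod using (_%_; m%n<n)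
open import Data.Fin using (Fin; toℕ; fromℕ<)
open import Data.Bool using (Bool; true; false; _∧_; _xor_)
open import Data.Product using (∃; _×_)
open import Relation.Binary.PropositionalEquality using (_≡_)

-- Vectors in 𝔽₂ⁿ: functions Fin n → Bool (false = 0, true = 1; xor = +, ∧ = ·).
Vec₂ : ℕ → Set
Vec₂ n = Fin n → Bool

idx : (n : ℕ) .{{_ : NonZero n}} → ℕ → Fin n
idx n a = fromℕ< (m%n<n a n)

neg : (n : ℕ) .{{_ : NonZero n}} → Fin n → Fin n
neg n i = idx n (n ∸ toℕ i)

sumF : ∀ {n} → (Fin n → Bool) → Bool
sumF {zero}  f = false
sumF {suc n} f = f Data.Fin.zero xor sumF (λ i → f (Data.Fin.suc i))


_·_ : ∀ {n} → Vec₂ n → Vec₂ n → Bool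
v · w = sumF (λ i → v i ∧ w i)

σ : (n : ℕ) .{{_ : NonZero n}} → Vec₂ n → Vec₂ n
σ n x j = x (idx n (toℕ j + (n ∸ 1)))

σ^ : (n : ℕ) .{{_ : NonZero n}} → ℕ → Vec₂ n → Vec₂ n
σ^ n zero    x = x
σ^ n (suc k) x = σ n (σ^ n k x)

WorkTogether : (n : ℕ) .{{_ : NonZero n}} → Vec₂ n → Vec₂ n → Set
WorkTogether n v w =
  (x : Vec₂ n) → ∃ λ (k : Fin n) →
    (v · σ^ n (toℕ k) x ≡ false) × (w · σ^ n (toℕ k) x ≡ false)

ē : (n : ℕ) → Vec₂ n
ē (suc n) Data.Fin.zero    = false
ē (suc n) (Data.Fin.suc i) = true

module Submission where

-- Read indices mod n, write S = Σₜ xₜ, and for a shift c put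
--   A(c) = Σⱼ vⱼ x_{j+c}     (the correlation of v with x),
-- so that the two dot products with σ^k x are A(−k) and x_{−k} + S.
-- We need a c with A(c) = 0 and x_c = S.  Two sums kill every alternative:
--   (1) Σ_c A(c)     = S · Σⱼ vⱼ               = 0,
--   (2) Σ_c x_c A(c) = Σⱼ vⱼ h(j),  h(j) = Σₜ xₜ x_{t+j},
-- and both vanish since vⱼ and the autocorrelation h are invariant under
-- j ↦ −j, v₀ = 0 and n is odd: the terms j and n − j cancel in pairs.
-- If no good c existed, then for S = 1 every c with x_c = 1 has A(c) = 1, so
-- (2) would equal S = 1; and for S = 0 every c with x_c = 0 has A(c) = 1, so
-- (1) would equal n + S + (2) = 1.
-- The file develops finite 𝔽₂-sums over ℕ-ranges, then periodic
-- correlations, then this counting argument, and finally translates the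
-- Fin-indexed definitions of Defs (dot product, cyclic shift) into it.

open import Defs
open import Data.Nat using (ℕ; zero; suc; _+_; _*_; _∸_; _<_; _≤_; z≤n; s≤s; NonZero)
open import Data.Nat.Properties
  using (+-comm; +-assoc; +-identityʳ; +-suc; +-∸-assoc; m+[n∸m]≡n; <⇒≤; +-commutativeSemigroup)
open import Data.Nat.DivMod
  using (_%_; %-distribˡ-+; %-distribˡ-*; m%n%n≡m%n; [m+n]%n≡m%n; [m+kn]%n≡m%n; m<n⇒m%n≡m)
open import Data.Nat.Tactic.RingSolver using (solve-∀)
open import Data.Fin using (Fin; toℕ) renaming (zero to fzero; suc to fsuc)
open import Data.Fin.Properties using (toℕ-injective; toℕ-fromℕ<; toℕ<n; any?)
open import Data.Bool using (Bool; true; false; not; _∧_; _xor_)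
open import Data.Bool.Properties
  using (xor-assoc; xor-comm; xor-same; xor-identityʳ; ∧-comm; ∧-zeroʳ; ∧-distribˡ-xor;
         ∧-commutativeMonoid; xor-∧-commutativeRing)
  renaming (_≟_ to _≟ᵇ_)
open import Algebra.Bundles using (CommutativeMonoid; CommutativeRing)
open import Data.Product using (∃; _×_; _,_)
open import Data.Empty using (⊥; ⊥-elim)
open import Relation.Nullary using (¬_; yes; no)
open import Relation.Nullary.Decidable using (_×-dec_)
open import Relation.Binary.PropositionalEquality
open import Algebra.Properties.CommutativeSemigroup
  (CommutativeRing.+-commutativeSemigroup xor-∧-commutativeRing)
  using () renaming (interchange to xor-interchange)
open import Algebra.Properties.CommutativeSemigroup
  (CommutativeMonoid.commutativeSemigroup ∧-commutativeMonoid)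
  using () renaming (x∙yz≈y∙xz to ∧-left-swap)
open import Algebra.Properties.CommutativeSemigroup +-commutativeSemigroup
  using () renaming (xy∙z≈xz∙y to +-right-swap)

⨁ : ℕ → (ℕ → Bool) → Bool
⨁ zero    f = false
⨁ (suc n) f = f 0 xor ⨁ n (λ j → f (suc j))

⨁-snoc : ∀ n f → ⨁ (suc n) f ≡ ⨁ n f xor f n
⨁-snoc zero    f = xor-identityʳ (f 0)
⨁-snoc (suc n) f = trans (cong (f 0 xor_) (⨁-snoc n (λ j → f (suc j))))
                         (sym (xor-assoc (f 0) _ _))

⨁-cong : ∀ n {f g} → (∀ j → j < n → f j ≡ g j) → ⨁ n f ≡ ⨁ n g
⨁-cong zero    eq = refl
⨁-cong (suc n) eq = cong₂ _xor_ (eq 0 (s≤s z≤n)) (⨁-cong n (λ j j<n → eq (suc j) (s≤s j<n)))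

⨁-xor : ∀ n f g → ⨁ n (λ j → f j xor g j) ≡ ⨁ n f xor ⨁ n g
⨁-xor zero    f g = refl
⨁-xor (suc n) f g = trans (cong ((f 0 xor g 0) xor_) (⨁-xor n _ _))
                          (xor-interchange (f 0) (g 0) _ _)

⨁-∧ˡ : ∀ n b f → ⨁ n (λ j → b ∧ f j) ≡ b ∧ ⨁ n f
⨁-∧ˡ zero    b f = sym (∧-zeroʳ b)
⨁-∧ˡ (suc n) b f = trans (cong ((b ∧ f 0) xor_) (⨁-∧ˡ n b _)) (sym (∧-distribˡ-xor b _ _))

⨁-false : ∀ n → ⨁ n (λ _ → false) ≡ false
⨁-false zero    = refl
⨁-false (suc n) = ⨁-false n

⨁-swap : ∀ m n (f : ℕ → ℕ → Bool) →
  ⨁ m (λ i → ⨁ n (λ j → f i j)) ≡ ⨁ n (λ j → ⨁ m (λ i → f i j))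
⨁-swap zero    n f = sym (⨁-false n)
⨁-swap (suc m) n f = trans (cong (⨁ n (f 0) xor_) (⨁-swap m n (λ i → f (suc i))))
                           (sym (⨁-xor n (f 0) _))

ē′ : ℕ → Bool
ē′ zero    = false
ē′ (suc _) = true

⨁-ē′ : ∀ d f → ⨁ (suc d) (λ j → ē′ j ∧ f j) ≡ f 0 xor ⨁ (suc d) f
⨁-ē′ d f = begin
    ⨁ d (λ j → f (suc j))
  ≡⟨ cong (_xor ⨁ d (λ j → f (suc j))) (sym (xor-same (f 0))) ⟩
    (f 0 xor f 0) xor ⨁ d (λ j → f (suc j))
  ≡⟨ xor-assoc (f 0) (f 0) _ ⟩
    f 0 xor ⨁ (suc d) f ∎
  where open ≡-Reasoning

Periodic : ℕ → (ℕ → Bool) → Set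
Periodic n Q = ∀ t → Q (t + n) ≡ Q t

⨁-rotate₁ : ∀ d Q → Q (suc d) ≡ Q 0 → ⨁ (suc d) (λ t → Q (suc t)) ≡ ⨁ (suc d) Q
⨁-rotate₁ d Q wrap = begin
    ⨁ (suc d) (λ t → Q (suc t))
  ≡⟨ ⨁-snoc d (λ t → Q (suc t)) ⟩
    ⨁ d (λ t → Q (suc t)) xor Q (suc d)
  ≡⟨ cong (⨁ d (λ t → Q (suc t)) xor_) wrap ⟩
    ⨁ d (λ t → Q (suc t)) xor Q 0
  ≡⟨ xor-comm _ (Q 0) ⟩
    ⨁ (suc d) Q ∎
  where open ≡-Reasoning

⨁-rotate : ∀ d Q → Periodic (suc d) Q → ∀ c → ⨁ (suc d) (λ t → Q (t + c)) ≡ ⨁ (suc d) Q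
⨁-rotate d Q per zero    = ⨁-cong (suc d) (λ t _ → cong Q (+-identityʳ t))
⨁-rotate d Q per (suc c) = begin
    ⨁ (suc d) (λ t → Q (t + suc c))
  ≡⟨ ⨁-cong (suc d) (λ t _ → cong Q (+-suc t c)) ⟩
    ⨁ (suc d) (λ t → Q (suc t + c))
  ≡⟨ ⨁-rotate₁ d (λ t → Q (t + c)) (trans (cong Q (+-comm (suc d) c)) (per c)) ⟩
    ⨁ (suc d) (λ t → Q (t + c))
  ≡⟨ ⨁-rotate d Q per c ⟩
    ⨁ (suc d) Q ∎
  where open ≡-Reasoning

double : ℕ → ℕ
double zero    = zero
double (suc h) = suc (suc (double h))

-- A palindrome of even length has sum 0: its terms cancel in pairs.
⨁-palindrome : ∀ h f → (∀ j → j < double h → f j ≡ f (double h ∸ suc j)) →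
  ⨁ (double h) f ≡ false
⨁-palindrome zero    f pal = refl
⨁-palindrome (suc h) f pal = begin
    f 0 xor ⨁ (suc D) (λ j → f (suc j))
  ≡⟨ cong (f 0 xor_) (⨁-snoc D (λ j → f (suc j))) ⟩
    f 0 xor (⨁ D (λ j → f (suc j)) xor f (suc D))
  ≡⟨ cong (λ s → f 0 xor (s xor f (suc D))) (⨁-palindrome h (λ j → f (suc j)) inner) ⟩
    f 0 xor f (suc D)
  ≡⟨ cong (f 0 xor_) (sym (pal 0 (s≤s z≤n))) ⟩
    f 0 xor f 0
  ≡⟨ xor-same (f 0) ⟩
    false ∎
  where
  open ≡-Reasoning
  D = double h
  inner : ∀ j → j < D → f (suc j) ≡ f (suc (D ∸ suc j))
  inner j j<D = trans (pal (suc j) (s≤s (s≤s (<⇒≤ j<D))))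
                      (cong f (+-∸-assoc 1 j<D))

Reflective : ℕ → (ℕ → Bool) → Set
Reflective n g = ∀ j → j < n → g j ≡ g (n ∸ j)

⨁-reflective : ∀ h g → g 0 ≡ false → Reflective (suc (double h)) g →
  ⨁ (suc (double h)) g ≡ false
⨁-reflective h g g₀ refl-g =
  cong₂ _xor_ g₀ (⨁-palindrome h (λ j → g (suc j)) paired)
  where
  paired : ∀ j → j < double h → g (suc j) ≡ g (suc (double h ∸ suc j))
  paired j j<D = trans (refl-g (suc j) (s≤s j<D)) (cong g (+-∸-assoc 1 j<D))

⨁-odd-ones : ∀ h → ⨁ (suc (double h)) (λ _ → true) ≡ true
⨁-odd-ones h = cong (true xor_) (⨁-palindrome h (λ _ → true) (λ _ _ → refl))

module Correlation (d : ℕ) (X : ℕ → Bool) (X-periodic : Periodic (suc d) X) where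

  private
    n = suc d

  auto : ℕ → Bool
  auto c = ⨁ n (λ t → X t ∧ X (t + c))

  corr : (ℕ → Bool) → ℕ → Bool
  corr V c = ⨁ n (λ j → V j ∧ X (j + c))

  X-shift : ∀ t c → X (t + n + c) ≡ X (t + c)
  X-shift t c = trans (cong X (+-right-swap t n c)) (X-periodic (t + c))

  auto-reflect : ∀ j → j ≤ n → auto (n ∸ j) ≡ auto j
  auto-reflect j j≤n = begin
      auto (n ∸ j)
    ≡⟨ sym (⨁-rotate d Q Q-periodic j) ⟩
      ⨁ n (λ t → X (t + j) ∧ X (t + j + (n ∸ j)))
    ≡⟨ ⨁-cong n (λ t _ → cong (X (t + j) ∧_) (trans (cong X (wrap t)) (X-periodic t))) ⟩
      ⨁ n (λ t → X (t + j) ∧ X t)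
    ≡⟨ ⨁-cong n (λ t _ → ∧-comm (X (t + j)) (X t)) ⟩
      auto j ∎
    where
    open ≡-Reasoning
    Q : ℕ → Bool
    Q t = X t ∧ X (t + (n ∸ j))
    Q-periodic : Periodic n Q
    Q-periodic t = cong₂ _∧_ (X-periodic t) (X-shift t (n ∸ j))
    wrap : ∀ t → t + j + (n ∸ j) ≡ t + n
    wrap t = trans (+-assoc t j (n ∸ j)) (cong (t +_) (m+[n∸m]≡n j≤n))

  ⨁-X∧corr : ∀ V → ⨁ n (λ c → X c ∧ corr V c) ≡ ⨁ n (λ j → V j ∧ auto j)
  ⨁-X∧corr V = begin
      ⨁ n (λ c → X c ∧ corr V c)
    ≡⟨ ⨁-cong n (λ c _ → trans (sym (⨁-∧ˡ n (X c) (λ j → V j ∧ X (j + c)))) (⨁-cong n (λ j _ → regroup c j))) ⟩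
      ⨁ n (λ c → ⨁ n (λ j → V j ∧ (X c ∧ X (c + j))))
    ≡⟨ ⨁-swap n n (λ c j → V j ∧ (X c ∧ X (c + j))) ⟩
      ⨁ n (λ j → ⨁ n (λ c → V j ∧ (X c ∧ X (c + j))))
    ≡⟨ ⨁-cong n (λ j _ → ⨁-∧ˡ n (V j) (λ c → X c ∧ X (c + j))) ⟩
      ⨁ n (λ j → V j ∧ auto j) ∎
    where
    open ≡-Reasoning
    regroup : ∀ c j → X c ∧ (V j ∧ X (j + c)) ≡ V j ∧ (X c ∧ X (c + j))
    regroup c j = trans (∧-left-swap (X c) (V j) _) (cong (λ m → V j ∧ (X c ∧ X m)) (+-comm j c))

  ⨁-corr : ∀ V → ⨁ n (corr V) ≡ ⨁ n X ∧ ⨁ n V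
  ⨁-corr V = begin
      ⨁ n (corr V)
    ≡⟨ ⨁-swap n n (λ c j → V j ∧ X (j + c)) ⟩
      ⨁ n (λ j → ⨁ n (λ c → V j ∧ X (j + c)))
    ≡⟨ ⨁-cong n (λ j _ → trans (⨁-∧ˡ n (V j) (λ c → X (j + c))) (cong (V j ∧_) (full-period j))) ⟩
      ⨁ n (λ j → V j ∧ ⨁ n X)
    ≡⟨ ⨁-cong n (λ j _ → ∧-comm (V j) (⨁ n X)) ⟩
      ⨁ n (λ j → ⨁ n X ∧ V j)
    ≡⟨ ⨁-∧ˡ n (⨁ n X) V ⟩
      ⨁ n X ∧ ⨁ n V ∎
    where
    open ≡-Reasoning
    full-period : ∀ j → ⨁ n (λ c → X (j + c)) ≡ ⨁ n X
    full-period j = trans (⨁-cong n (λ c _ → cong X (+-comm j c))) (⨁-rotate d X X-periodic j)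

module OddCorrelation (h : ℕ) (X : ℕ → Bool) (X-periodic : Periodic (suc (double h)) X)
                      (V : ℕ → Bool) (V₀ : V 0 ≡ false) (V-refl : Reflective (suc (double h)) V) where

  open Correlation (double h) X X-periodic

  ⨁-X∧corr-vanishes : ⨁ (suc (double h)) (λ c → X c ∧ corr V c) ≡ false
  ⨁-X∧corr-vanishes = trans (⨁-X∧corr V)
    (⨁-reflective h (λ j → V j ∧ auto j) (cong (_∧ auto 0) V₀)
      (λ j j<n → cong₂ _∧_ (V-refl j j<n) (sym (auto-reflect j (<⇒≤ j<n)))))

  ⨁-corr-vanishes : ⨁ (suc (double h)) (corr V) ≡ false
  ⨁-corr-vanishes = trans (⨁-corr V)
    (trans (cong (⨁ (suc (double h)) X ∧_) (⨁-reflective h V V₀ V-refl)) (∧-zeroʳ _))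

∧-forced : ∀ x a → (a ≡ false → x ≡ true → ⊥) → x ∧ a ≡ x
∧-forced false a  _      = refl
∧-forced true true _     = refl
∧-forced true false bad  = ⊥-elim (bad refl refl)

complement-forced : ∀ x a → (a ≡ false → x ≡ false → ⊥) → a ≡ not x xor (x ∧ a)
complement-forced true  a     _   = refl
complement-forced false true  _   = refl
complement-forced false false bad = ⊥-elim (bad refl refl)

true≢false : true ≡ false → ⊥
true≢false ()

balanced-point : ∀ h (X A : ℕ → Bool) →
  ⨁ (suc (double h)) (λ c → X c ∧ A c) ≡ false → ⨁ (suc (double h)) A ≡ false →
  ¬ (∀ c → c < suc (double h) → A c ≡ false → X c ≡ ⨁ (suc (double h)) X → ⊥)
balanced-point h X A XA≡0 A≡0 none with ⨁ (suc (double h)) X in S≡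
... | true  = true≢false (begin
      true                     ≡⟨ sym S≡ ⟩
      ⨁ n X                    ≡⟨ ⨁-cong n (λ c c<n → sym (∧-forced (X c) (A c) (none c c<n))) ⟩
      ⨁ n (λ c → X c ∧ A c)    ≡⟨ XA≡0 ⟩
      false                    ∎)
  where
  open ≡-Reasoning
  n = suc (double h)
... | false = true≢false (begin
      true                                          ≡⟨ sym (⨁-odd-ones h) ⟩
      ⨁ n (λ _ → true)                              ≡⟨ sym (xor-identityʳ _) ⟩
      ⨁ n (λ _ → true) xor false                    ≡⟨ cong (⨁ n (λ _ → true) xor_) (sym S≡) ⟩
      ⨁ n (λ _ → true) xor ⨁ n X                    ≡⟨ sym (⨁-xor n (λ _ → true) X) ⟩
      ⨁ n (λ c → not (X c))                         ≡⟨ sym (xor-identityʳ _) ⟩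
      ⨁ n (λ c → not (X c)) xor false               ≡⟨ cong (⨁ n (λ c → not (X c)) xor_) (sym XA≡0) ⟩
      ⨁ n (λ c → not (X c)) xor ⨁ n (λ c → X c ∧ A c) ≡⟨ sym (⨁-xor n (λ c → not (X c)) (λ c → X c ∧ A c)) ⟩
      ⨁ n (λ c → not (X c) xor (X c ∧ A c))         ≡⟨ ⨁-cong n (λ c c<n → sym (complement-forced (X c) (A c) (none c c<n))) ⟩
      ⨁ n A                                         ≡⟨ A≡0 ⟩
      false                                         ∎)
  where
  open ≡-Reasoning
  n = suc (double h)

toℕ-idx : ∀ n .{{_ : NonZero n}} a → toℕ (idx n a) ≡ a % n
toℕ-idx n a = toℕ-fromℕ< _

idx-cong : ∀ n .{{_ : NonZero n}} a b → a % n ≡ b % n → idx n a ≡ idx n b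
idx-cong n a b eq = toℕ-injective (trans (toℕ-idx n a) (trans eq (sym (toℕ-idx n b))))

idx-toℕ : ∀ n .{{_ : NonZero n}} (i : Fin n) → idx n (toℕ i) ≡ i
idx-toℕ n i = toℕ-injective (trans (toℕ-idx n (toℕ i)) (m<n⇒m%n≡m (toℕ<n i)))

sumF≡⨁ : ∀ {n} (f : Fin n → Bool) (g : ℕ → Bool) → (∀ i → f i ≡ g (toℕ i)) → sumF f ≡ ⨁ n g
sumF≡⨁ {zero}  f g eq = refl
sumF≡⨁ {suc n} f g eq = cong₂ _xor_ (eq fzero) (sumF≡⨁ (λ i → f (fsuc i)) (λ m → g (suc m)) (λ i → eq (fsuc i)))

ē≡ē′ : ∀ n (i : Fin n) → ē n i ≡ ē′ (toℕ i)
ē≡ē′ (suc n) fzero    = refl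
ē≡ē′ (suc n) (fsuc i) = refl

%-absorbˡ : ∀ n .{{_ : NonZero n}} a b → (a % n + b) % n ≡ (a + b) % n
%-absorbˡ n a b = trans (%-distribˡ-+ (a % n) b n)
  (trans (cong (λ r → (r + b % n) % n) (m%n%n≡m%n a n)) (sym (%-distribˡ-+ a b n)))

%-cong-+ˡ : ∀ n .{{_ : NonZero n}} j {a b} → a % n ≡ b % n → (j + a) % n ≡ (j + b) % n
%-cong-+ˡ n j {a} {b} eq = trans (%-distribˡ-+ j a n)
  (trans (cong (λ r → (j % n + r) % n) eq) (sym (%-distribˡ-+ j b n)))

-- Multiplication by d is an involution modulo d + 1, since d ≡ −1.
%-times-pred-involutive : ∀ d m → ((m * d) % suc d * d) % suc d ≡ m % suc d
%-times-pred-involutive d m = begin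
    ((m * d) % n * d) % n
  ≡⟨ %-distribˡ-* ((m * d) % n) d n ⟩
    ((m * d) % n % n * (d % n)) % n
  ≡⟨ cong (λ r → (r * (d % n)) % n) (m%n%n≡m%n (m * d) n) ⟩
    ((m * d) % n * (d % n)) % n
  ≡⟨ sym (%-distribˡ-* (m * d) d n) ⟩
    (m * d * d) % n
  ≡⟨ sym ([m+kn]%n≡m%n (m * d * d) m n) ⟩
    (m * d * d + m * n) % n
  ≡⟨ cong (_% n) (square-identity m d) ⟩
    (m + m * d * n) % n
  ≡⟨ [m+kn]%n≡m%n m (m * d) n ⟩
    m % n ∎
  where
  open ≡-Reasoning
  n = suc d
  square-identity : ∀ m d → m * d * d + m * suc d ≡ m + m * d * suc d
  square-identity = solve-∀

module Shifts (d : ℕ) (x : Vec₂ (suc d)) where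

  private
    n = suc d

  X : ℕ → Bool
  X m = x (idx n m)

  X-mod : ∀ a b → a % n ≡ b % n → X a ≡ X b
  X-mod a b eq = cong x (idx-cong n a b eq)

  X-periodic : Periodic n X
  X-periodic t = X-mod (t + n) t ([m+n]%n≡m%n t n)

  -- σ^k moves index j to j + k·d ≡ j − k.
  σ^-lookup : ∀ k j → σ^ n k x j ≡ X (toℕ j + k * d)
  σ^-lookup zero    j = cong x (sym (trans (cong (idx n) (+-identityʳ (toℕ j))) (idx-toℕ n j)))
  σ^-lookup (suc k) j = trans (σ^-lookup k (idx n (toℕ j + d)))
                              (X-mod (toℕ (idx n (toℕ j + d)) + k * d) (toℕ j + suc k * d) (begin
      (toℕ (idx n (toℕ j + d)) + k * d) % n ≡⟨ cong (λ r → (r + k * d) % n) (toℕ-idx n (toℕ j + d)) ⟩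
      ((toℕ j + d) % n + k * d) % n         ≡⟨ %-absorbˡ n (toℕ j + d) (k * d) ⟩
      (toℕ j + d + k * d) % n               ≡⟨ cong (_% n) (+-assoc (toℕ j) d (k * d)) ⟩
      (toℕ j + suc k * d) % n               ∎))
    where open ≡-Reasoning

  open Correlation d X X-periodic

  dot-σ^ : (w : Vec₂ n) (w′ : ℕ → Bool) → (∀ i → w i ≡ w′ (toℕ i)) → ∀ k →
    w · σ^ n k x ≡ corr w′ (k * d)
  dot-σ^ w w′ eq k = sumF≡⨁ (λ i → w i ∧ σ^ n k x i) (λ j → w′ j ∧ X (j + k * d))
                             (λ i → cong₂ _∧_ (eq i) (σ^-lookup k i))

  dot-ē : ∀ k → ē n · σ^ n k x ≡ X (k * d) xor ⨁ n X
  dot-ē k = trans (dot-σ^ (ē n) ē′ (ē≡ē′ n) k)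
    (trans (⨁-ē′ d (λ j → X (j + k * d))) (cong (X (k * d) xor_) (⨁-rotate d X X-periodic (k * d))))

  corr-mod : ∀ V a b → a % n ≡ b % n → corr V a ≡ corr V b
  corr-mod V a b eq = ⨁-cong n (λ j _ → cong (V j ∧_) (X-mod (j + a) (j + b) (%-cong-+ˡ n j eq)))

  -- Every residue c is reached as k·d by the shift k = c·d.
  shift-to : ∀ c → (toℕ (idx n (c * d)) * d) % n ≡ c % n
  shift-to c = trans (cong (λ r → (r * d) % n) (toℕ-idx n (c * d))) (%-times-pred-involutive d c)

work-together-odd : ∀ h (v : Vec₂ (suc (double h))) → v (idx (suc (double h)) 0) ≡ false →
  (∀ i → v i ≡ v (neg (suc (double h)) i)) → WorkTogether (suc (double h)) v (ē (suc (double h)))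
work-together-odd h v v₀ v-sym x
  with any? (λ k → (v · σ^ _ (toℕ k) x ≟ᵇ false) ×-dec (ē _ · σ^ _ (toℕ k) x ≟ᵇ false))
... | yes found = found
... | no none   = ⊥-elim (balanced-point h X (corr V)
                    ⨁-X∧corr-vanishes ⨁-corr-vanishes
                    (λ c _ A≡0 X≡S → none (k c , dot-v c A≡0 , dot-e c X≡S)))
  where
  n = suc (double h)
  open Shifts (double h) x
  open Correlation (double h) X X-periodic
  V : ℕ → Bool
  V m = v (idx n m)
  V-refl : Reflective n V
  V-refl j j<n = trans (v-sym (idx n j))
    (cong (λ r → v (idx n (n ∸ r))) (trans (toℕ-idx n j) (m<n⇒m%n≡m j<n)))
  open OddCorrelation h X X-periodic V v₀ V-refl
  k : ℕ → Fin n
  k c = idx n (c * double h)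
  dot-v : ∀ c → corr V c ≡ false → v · σ^ n (toℕ (k c)) x ≡ false
  dot-v c A≡0 = trans (dot-σ^ v V (λ i → cong v (sym (idx-toℕ n i))) (toℕ (k c)))
                      (trans (corr-mod V (toℕ (k c) * double h) c (shift-to c)) A≡0)
  dot-e : ∀ c → X c ≡ ⨁ n X → ē n · σ^ n (toℕ (k c)) x ≡ false
  dot-e c X≡S = trans (dot-ē (toℕ (k c)))
    (trans (cong (_xor ⨁ n X) (trans (X-mod (toℕ (k c) * double h) c (shift-to c)) X≡S)) (xor-same (⨁ n X)))

odd⇒suc-double : ∀ n → n % 2 ≡ 1 → ∃ λ h → n ≡ suc (double h)
odd⇒suc-double zero ()
odd⇒suc-double (suc zero) _ = zero , refl
odd⇒suc-double (suc (suc m)) odd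
  with odd⇒suc-double m (trans (sym ([m+n]%n≡m%n m 2)) (trans (cong (_% 2) (+-comm m 2)) odd))
... | h , refl = suc h , refl

proposition3p5 : (n : ℕ) .{{_ : NonZero n}} → n % 2 ≡ 1 → (v : Vec₂ n) →
    v (idx n 0) ≡ false → (∀ i → v i ≡ v (neg n i)) →
    WorkTogether n v (ē n)
proposition3p5 n odd v v₀ v-sym with odd⇒suc-double n odd
... | h , refl = work-together-odd h v v₀ v-sym
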